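{- Let $s$ be a Sturmian word with slope $\alpha$. Then $s$ is prefix normal if and only if $s = 1c_{\alpha}$, where $c_{\alpha}$ is the characteristic word with slope $\alpha$.
   Context: Binary words are indexed from $1$. For a (finite or infinite) binary word $w$, $P_w(i)$ denotes the number of $1$s in the prefix of length $i$ of $w$. $w$ is (1-)prefix normal if for every $i\ge 1$ (with $i\le |w|$ if $w$ is finite), every factor (contiguous subword) of $w$ of length $i$ has at most $P_w(i)$ ones. A binary word is balanced if any two factors of the same length differ in their number of $1$s by at most $1$. An infinite binary word is Sturmian if it is balanced and not ultimately periodic (i.e. not of the form $vu^\omega$ with $u$ nonempty). The slope of an infinite word $w$ is $\lim_{i\to\infty}P_w(i)/i$ (this limit exists for Sturmian words and is irrational). For irrational $\alpha\in(0,1)$, the characteristic word $c_\alpha$ is the infinite word with $c_\alpha(n)=\lfloor \alpha(n+1)\rfloor-\lfloor \alpha n\rfloor$ for $n\ge 1$. -}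

module Defs where

open import Level using (0ℓ)
open import Data.Bool using (Bool; true; false)
open import Data.Nat using (ℕ; zero; suc; _+_; _≤_; _∸_)
open import Data.Integer using (+_)
open import Data.Rational using (ℚ; _/_) renaming (_<_ to _<ℚ_)
open import Data.Product using (_×_; ∃; Σ)
open import Data.Sum using (_⊎_)
open import Data.Empty using (⊥)
open import Relation.Nullary using (¬_)
open import Relation.Binary.PropositionalEquality using (_≡_)

-- An infinite binary word. CONVENTION: 0-based storage; the letter at
-- (1-based) position i of the paper is  w (i ∸ 1), i.e. w 0 is the first letter.
Word : Set
Word = ℕ → Bool

bit : Bool → ℕ
bit true  = 1
bit false = 0

ones : Word → ℕ → ℕ → ℕ
ones w j zero    = 0
ones w j (suc i) = bit (w j) + ones w (suc j) i

P : Word → ℕ → ℕ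
P w i = ones w 0 i

PrefixNormal : Word → Set
PrefixNormal w = ∀ (i j : ℕ) → ones w j i ≤ P w i

Balanced : Word → Set
Balanced w = ∀ (i j k : ℕ) → ones w j i ≤ ones w k i + 1

-- ultimately periodic: w = v u^ω with u nonempty, i.e. there are n (= |v|)
-- and p ≥ 1 (= |u|) with w(m + p) = w(m) for all m ≥ n.
UltimatelyPeriodic : Word → Set
UltimatelyPeriodic w =
  Σ ℕ λ n → Σ ℕ λ p → (1 ≤ p) × (∀ m → n ≤ m → w (m + p) ≡ w m)

Sturmian : Word → Set
Sturmian w = Balanced w × ¬ UltimatelyPeriodic w

-- Real numbers as (two-sided, located) Dedekind cuts on ℚ.
-- L q  means  q < α ;  U q  means  α < q.
record Real : Set₁ where
  field
    L U        : ℚ → Set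
    L-inhabited : ∃ L
    U-inhabited : ∃ U
    L-down     : ∀ {p q} → L q → p <ℚ q → L p
    L-round    : ∀ {q} → L q → ∃ λ r → q <ℚ r × L r
    U-up       : ∀ {p q} → U p → p <ℚ q → U q
    U-round    : ∀ {q} → U q → ∃ λ r → r <ℚ q × U r
    disjoint   : ∀ {q} → L q → U q → ⊥
    located    : ∀ {q r} → q <ℚ r → L q ⊎ U r

open Real public

ratio : Word → ℕ → ℚ
ratio w k = (+ P w (suc k)) / suc k

-- α is the slope of w:  lim_{i→∞} P_w(i)/i = α, i.e. for every rational
-- q < α eventually q < P_w(i)/i, and for every rational q > α eventually
-- P_w(i)/i < q.
IsSlope : Word → Real → Set
IsSlope w α =
  (∀ q → L α q → Σ ℕ λ N → ∀ k → N ≤ k → q <ℚ ratio w k) ×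
  (∀ q → U α q → Σ ℕ λ N → ∀ k → N ≤ k → ratio w k <ℚ q)

-- IsFloor α m f  :  f = ⌊ α · m ⌋  (for m ≥ 1), i.e. f ≤ α m < f + 1,
-- i.e. not (α < f/m) and α < (f+1)/m.
IsFloor : Real → (m : ℕ) → .{{_ : Data.Nat.NonZero m}} → ℕ → Set
IsFloor α m f = (¬ U α ((+ f) / m)) × U α ((+ suc f) / m)

-- s = 1 c_α, where c_α(n) = ⌊α(n+1)⌋ − ⌊αn⌋ (n ≥ 1).  In 0-based storage:
-- s 0 = 1 and s n = c_α(n) for n ≥ 1.
IsOneCharWord : Real → Word → Set
IsOneCharWord α s =
  (s 0 ≡ true) ×
  (∀ (k f g : ℕ) → IsFloor α (suc k) f → IsFloor α (suc (suc k)) g →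
     bit (s (suc k)) ≡ g ∸ f)

-- For a Sturmian word s of slope α and n ≥ 1, the windows of length n carry either
-- ⌊αn⌋ or ⌊αn⌋ + 1 ones: balance bounds the spread by one, aperiodicity forces
-- both counts to occur, the density bound puts the minimum a
-- at or below αn, and a second use of aperiodicity yields two minimal windows a
-- multiple of n apart, which pushes the density of a longer window, hence α,
-- strictly below (a + 1)/n. So s is prefix normal iff P(n) = ⌊αn⌋ + 1 for all
-- n ≥ 1, which is exactly s = 1c_α. The classical steps are carried out in the
-- double-negation monad; every conclusion drawn from it is a decidable equation.
module Submission where

open import Defs
open import Level using (0ℓ)
open import Function.Base using (case_of_)
open import Function.Bundles using (_⇔_; mk⇔)
open import Data.Bool using (true; false)
import Data.Bool.Properties as Bool
open import Data.Nat using (ℕ; zero; suc; _+_; _*_; _∸_; _⊔_; _≤_; _<_; z≤n; s≤s; _≟_; _≤?_)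
open import Data.Nat.Properties
open import Data.Nat.DivMod using (_%_; m≡m%n+[m/n]*n; m%n<n; m*n/n≡m; /-monoˡ-≤)
  renaming (_/_ to _div_)
open import Data.Nat.Tactic.RingSolver using (solve-∀)
open import Data.Integer using (+<+)
import Data.Integer as ℤ
import Data.Integer.Properties as ℤ
open import Data.Rational using (toℚᵘ; _/_) renaming (_<_ to _<ℚ_)
import Data.Rational.Properties as ℚ
open import Data.Rational.Unnormalised using (mkℚᵘ; *<*) renaming (_≃_ to _≃ᵘ_)
import Data.Rational.Unnormalised.Properties as ℚᵘ
open import Data.Product using (_×_; _,_; proj₁; proj₂; ∃)
open import Data.Sum using (inj₁; inj₂)
open import Data.Empty using (⊥-elim)
open import Effect.Monad using (RawMonad)
open import Relation.Nullary using (¬_; yes; no)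
open import Relation.Nullary.Decidable using (decidable-stable; ¬¬-excluded-middle)
open import Relation.Nullary.Negation using (DoubleNegation; ¬¬-Monad)
open import Relation.Binary.Definitions using (tri<; tri≈; tri>)
open import Relation.Binary.PropositionalEquality

open RawMonad (¬¬-Monad {0ℓ}) using (pure; _>>=_)


toℚᵘ-/ : ∀ A b → toℚᵘ (ℤ.+ A / suc b) ≃ᵘ mkℚᵘ (ℤ.+ A) b
toℚᵘ-/ A b = ℚ.toℚᵘ-fromℚᵘ (mkℚᵘ (ℤ.+ A) b)

*<*⇒/<ℚ/ : ∀ A b C d → A * suc d < C * suc b → ℤ.+ A / suc b <ℚ ℤ.+ C / suc d
*<*⇒/<ℚ/ A b C d lt = ℚ.toℚᵘ-cancel-<
  (ℚᵘ.<-respˡ-≃ (ℚᵘ.≃-sym (toℚᵘ-/ A b)) (ℚᵘ.<-respʳ-≃ (ℚᵘ.≃-sym (toℚᵘ-/ C d))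
    (*<* (subst₂ ℤ._<_ (ℤ.pos-* A (suc d)) (ℤ.pos-* C (suc b)) (+<+ lt)))))

/<ℚ/⇒*<* : ∀ A b C d → ℤ.+ A / suc b <ℚ ℤ.+ C / suc d → A * suc d < C * suc b
/<ℚ/⇒*<* A b C d lt
  with ℚᵘ.<-respˡ-≃ (toℚᵘ-/ A b) (ℚᵘ.<-respʳ-≃ (toℚᵘ-/ C d) (ℚ.toℚᵘ-mono-< lt))
... | *<* p with subst₂ ℤ._<_ (sym (ℤ.pos-* A (suc d))) (sym (ℤ.pos-* C (suc b))) p
...   | +<+ q = q


bit-injective : ∀ a b → bit a ≡ bit b → a ≡ b
bit-injective true  true  _ = refl
bit-injective false false _ = refl

ones₁≡suc⇒true×zero : ∀ w j {a} → ones w j 1 ≡ suc a → w j ≡ true × a ≡ 0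
ones₁≡suc⇒true×zero w j e with w j
... | true = refl , sym (suc-injective e)

ones-+ : ∀ w j m k → ones w j (m + k) ≡ ones w j m + ones w (j + m) k
ones-+ w j zero    k = cong (λ i → ones w i k) (sym (+-identityʳ j))
ones-+ w j (suc m) k = begin
  bit (w j) + ones w (suc j) (m + k)
    ≡⟨ cong (bit (w j) +_) (ones-+ w (suc j) m k) ⟩
  bit (w j) + (ones w (suc j) m + ones w (suc j + m) k)
    ≡⟨ sym (+-assoc (bit (w j)) _ _) ⟩
  bit (w j) + ones w (suc j) m + ones w (suc j + m) k
    ≡⟨ cong (λ i → bit (w j) + ones w (suc j) m + ones w i k) (sym (+-suc j m)) ⟩
  bit (w j) + ones w (suc j) m + ones w (j + suc m) k ∎
  where open ≡-Reasoning

ones-suc : ∀ w j n → ones w j (suc n) ≡ ones w j n + bit (w (j + n))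
ones-suc w j n = begin
  ones w j (suc n)                     ≡⟨ cong (ones w j) (+-comm 1 n) ⟩
  ones w j (n + 1)                     ≡⟨ ones-+ w j n 1 ⟩
  ones w j n + (bit (w (j + n)) + 0)   ≡⟨ cong (ones w j n +_) (+-identityʳ _) ⟩
  ones w j n + bit (w (j + n))         ∎
  where open ≡-Reasoning

ones-≤-suc : ∀ w j n → ones w j n ≤ ones w j (suc n)
ones-≤-suc w j n = subst (ones w j n ≤_) (sym (ones-suc w j n)) (m≤m+n _ _)

ones-*-≤ : ∀ w n c → (∀ x → ones w x n ≤ c) → ∀ N j → ones w j (N * n) ≤ N * c
ones-*-≤ w n c bound zero    j = z≤n
ones-*-≤ w n c bound (suc N) j rewrite ones-+ w j n (N * n) =
  +-mono-≤ (bound j) (ones-*-≤ w n c bound N (j + n))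

ones-*-≥ : ∀ w n c → (∀ x → c ≤ ones w x n) → ∀ N j → N * c ≤ ones w j (N * n)
ones-*-≥ w n c bound zero    j = z≤n
ones-*-≥ w n c bound (suc N) j rewrite ones-+ w j n (N * n) =
  +-mono-≤ (bound j) (ones-*-≥ w n c bound N (j + n))


constant-windows⇒ultimatelyPeriodic :
  ∀ w n X c → (∀ x → X ≤ x → ones w x (suc n) ≡ c) → UltimatelyPeriodic w
constant-windows⇒ultimatelyPeriodic w n X c const =
  X , suc n , s≤s z≤n , λ m X≤m →
    sym (bit-injective _ _ (+-cancelʳ-≡ c _ _ (shifted m X≤m)))
  where
  shifted : ∀ m → X ≤ m → bit (w m) + c ≡ bit (w (m + suc n)) + c
  shifted m X≤m = begin
    bit (w m) + c
      ≡⟨ cong (bit (w m) +_) (sym (const (suc m) (≤-trans X≤m (n≤1+n m)))) ⟩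
    ones w m (suc (suc n))
      ≡⟨ ones-suc w m (suc n) ⟩
    ones w m (suc n) + bit (w (m + suc n))
      ≡⟨ cong (_+ bit (w (m + suc n))) (const m X≤m) ⟩
    c + bit (w (m + suc n))
      ≡⟨ +-comm c _ ⟩
    bit (w (m + suc n)) + c ∎
    where open ≡-Reasoning

Eventually : (ℕ → Set) → Set
Eventually Q = ∃ λ X → ∀ t → X ≤ t → Q t

eventually-∀< : {Q : ℕ → ℕ → Set} → (∀ i → DoubleNegation (Eventually (Q i))) →
  ∀ k → DoubleNegation (Eventually λ t → ∀ i → i < k → Q i t)
eventually-∀< ev zero = pure (0 , λ _ _ _ ())
eventually-∀< ev (suc k) = do
  (X , below-k) ← eventually-∀< ev k
  (Y , at-k) ← ev k
  pure (X ⊔ Y , λ t X⊔Y≤t i i<1+k → case m<1+n⇒m<n∨m≡n i<1+k of λ where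
    (inj₁ i<k)  → below-k t (≤-trans (m≤m⊔n X Y) X⊔Y≤t) i i<k
    (inj₂ refl) → at-k t (≤-trans (m≤n⊔m X Y) X⊔Y≤t))


*-swapˡ : ∀ a b c → a * (b * c) ≡ b * a * c
*-swapˡ = solve-∀

module _ (w : Word) (α : Real) (slope : IsSlope w α) where

  slope-≥ : ∀ {n a} → (∀ x → a ≤ ones w x (suc n)) → ¬ U α (ℤ.+ a / suc n)
  slope-≥ {n} {a} lower u with proj₂ slope _ u
  ... | N , below = <⇒≱ prefix<aN (*-monoˡ-≤ (suc n) (ones-*-≥ w (suc n) a lower (suc N) 0))
    where
    prefix<aN : P w (suc N * suc n) * suc n < suc N * a * suc n
    prefix<aN = subst (P w (suc N * suc n) * suc n <_) (*-swapˡ a (suc N) (suc n))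
      (/<ℚ/⇒*<* (P w (suc N * suc n)) (n + N * suc n) a n
        (below (n + N * suc n) (≤-trans (m≤m*n N (suc n)) (m≤n+m _ n))))

  slope-≤ : ∀ {n c} → (∀ x → ones w x (suc n) ≤ c) → ¬ L α (ℤ.+ c / suc n)
  slope-≤ {n} {c} upper l with proj₁ slope _ l
  ... | N , above = <⇒≱ cN<prefix (*-monoˡ-≤ (suc n) (ones-*-≤ w (suc n) c upper (suc N) 0))
    where
    cN<prefix : suc N * c * suc n < P w (suc N * suc n) * suc n
    cN<prefix = subst (_< P w (suc N * suc n) * suc n) (*-swapˡ c (suc N) (suc n))
      (/<ℚ/⇒*<* c n (P w (suc N * suc n)) (n + N * suc n)
        (above (n + N * suc n) (≤-trans (m≤m*n N (suc n)) (m≤n+m _ n))))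

IsFloor-unique : ∀ {α m f g} → IsFloor α (suc m) f → IsFloor α (suc m) g → f ≡ g
IsFloor-unique {α} {m} {f} {g} (¬Uf , Uf+1) (¬Ug , Ug+1) =
  ≤-antisym (<⇒≤pred (below-floor f (suc g) ¬Uf Ug+1))
            (<⇒≤pred (below-floor g (suc f) ¬Ug Uf+1))
  where
  below-floor : ∀ x y → ¬ U α (ℤ.+ x / suc m) → U α (ℤ.+ y / suc m) → x < y
  below-floor x y ¬Ux Uy with <-cmp x y
  ... | tri< x<y _ _ = x<y
  ... | tri≈ _ refl _ = ⊥-elim (¬Ux Uy)
  ... | tri> _ _ y<x = ⊥-elim (¬Ux (U-up α Uy (*<*⇒/<ℚ/ y m x m (*-monoˡ-< (suc m) y<x))))


record IsMinOnes (w : Word) (n a : ℕ) : Set where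
  constructor isMinOnes
  field
    lower    : ∀ x → a ≤ ones w x n
    attained : ∃ λ j → ones w j n ≡ a

open IsMinOnes

minOnes-mono : ∀ {w n a b} → IsMinOnes w n a → IsMinOnes w (suc n) b → a ≤ b
minOnes-mono {w} {n} (isMinOnes lowerₐ _) (isMinOnes _ (j , refl)) =
  ≤-trans (lowerₐ j) (ones-≤-suc w j n)

module _ {w : Word} (balanced : Balanced w) where

  minOnes-exists : ∀ n → DoubleNegation (∃ (IsMinOnes w n))
  minOnes-exists n = do
    d ← ¬¬-excluded-middle {A = ∃ λ j → ones w j n < P w n}
    pure (case d of λ where
      (yes (j , below-prefix)) → ones w j n , isMinOnes
        (λ x → ≤-pred (≤-trans below-prefix (subst (P w n ≤_) (+-comm _ 1) (balanced n 0 x))))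
        (j , refl)
      (no none) → P w n , isMinOnes (λ x → ≮⇒≥ λ lt → none (x , lt)) (0 , refl))

  ones-≤-suc-min : ∀ {n a} → IsMinOnes w n a → ∀ x → ones w x n ≤ suc a
  ones-≤-suc-min {n} {a} (isMinOnes _ (j , e)) x =
    subst (ones w x n ≤_) (trans (cong (_+ 1) e) (+-comm a 1)) (balanced n x j)

  ones≢min⇒suc-min : ∀ {n a} → IsMinOnes w n a → ∀ x → ones w x n ≢ a → ones w x n ≡ suc a
  ones≢min⇒suc-min min x ≢a =
    ≤-antisym (ones-≤-suc-min min x) (≤∧≢⇒< (lower min x) (λ e → ≢a (sym e)))

  ones-across-aligned-mins : ∀ {n a} → IsMinOnes w n a → ∀ x t →
    ones w x n ≡ a → ones w (x + suc t * n) n ≡ a →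
    ones w x (n + (t * n + n)) ≤ a + (t * suc a + a)
  ones-across-aligned-mins {n} {a} min x t e₁ e₂ = begin
    ones w x (n + (t * n + n))
      ≡⟨ ones-+ w x n (t * n + n) ⟩
    ones w x n + ones w (x + n) (t * n + n)
      ≡⟨ cong₂ _+_ e₁ (ones-+ w (x + n) (t * n) n) ⟩
    a + (ones w (x + n) (t * n) + ones w (x + n + t * n) n)
      ≡⟨ cong (λ y → a + (ones w (x + n) (t * n) + ones w y n)) (+-assoc x n (t * n)) ⟩
    a + (ones w (x + n) (t * n) + ones w (x + suc t * n) n)
      ≡⟨ cong (λ k → a + (ones w (x + n) (t * n) + k)) e₂ ⟩
    a + (ones w (x + n) (t * n) + a)
      ≤⟨ +-monoʳ-≤ a (+-monoˡ-≤ a (ones-*-≤ w n (suc a) (ones-≤-suc-min min) t (x + n))) ⟩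
    a + (t * suc a + a) ∎
    where open ≤-Reasoning

AlignedMinPair : Word → ℕ → ℕ → Set
AlignedMinPair w n a = ∃ λ x → ∃ λ t → ones w x n ≡ a × ones w (x + suc t * n) n ≡ a

shift-by-multiple : ∀ i m {t₀ t} → t₀ < t → i + t₀ * m + suc (t ∸ suc t₀) * m ≡ i + t * m
shift-by-multiple i m {t₀} {t} t₀<t = begin
  i + t₀ * m + suc (t ∸ suc t₀) * m  ≡⟨ regroup i t₀ (t ∸ suc t₀) m ⟩
  i + (suc t₀ + (t ∸ suc t₀)) * m    ≡⟨ cong (λ u → i + u * m) (m+[n∸m]≡n t₀<t) ⟩
  i + t * m                          ∎
  where
  open ≡-Reasoning
  regroup : ∀ i t₀ d m → i + t₀ * m + suc d * m ≡ i + (suc t₀ + d) * m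
  regroup = solve-∀

module Sturmian (s : Word) (balanced : Balanced s) (aperiodic : ¬ UltimatelyPeriodic s)
                (α : Real) (slope : IsSlope s α) where

  suc-min-attained : ∀ {n a} → IsMinOnes s (suc n) a →
    DoubleNegation (∃ λ j → ones s j (suc n) ≡ suc a)
  suc-min-attained {n} {a} min ¬attained =
    aperiodic (constant-windows⇒ultimatelyPeriodic s n 0 a λ x _ →
      ≤-antisym (<⇒≤pred (≤∧≢⇒< (ones-≤-suc-min balanced min x) (λ e → ¬attained (x , e))))
                (lower min x))

  -- Otherwise every residue class mod n eventually only starts maximal windows,
  -- and then all windows of length n far enough out have a + 1 ones.
  minOnes-aligned : ∀ {n a} → IsMinOnes s (suc n) a → DoubleNegation (AlignedMinPair s (suc n) a)
  minOnes-aligned {n} {a} min ¬aligned = eventually-∀< eventually-max (suc n) λ (X , max) →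
    aperiodic (constant-windows⇒ultimatelyPeriodic s n (X * suc n) (suc a) λ x X*n≤x →
      subst (λ y → ones s y (suc n) ≡ suc a) (sym (m≡m%n+[m/n]*n x (suc n)))
        (max (x div suc n) (subst (_≤ x div suc n) (m*n/n≡m X (suc n)) (/-monoˡ-≤ (suc n) X*n≤x))
             (x % suc n) (m%n<n x (suc n))))
    where
    eventually-max : ∀ i → DoubleNegation (Eventually λ t → ones s (i + t * suc n) (suc n) ≡ suc a)
    eventually-max i = do
      d ← ¬¬-excluded-middle {A = ∃ λ t₀ → ones s (i + t₀ * suc n) (suc n) ≡ a}
      pure (case d of λ where
        (yes (t₀ , e)) → suc t₀ , λ t t₀<t →
          ones≢min⇒suc-min balanced min _ λ e′ →
            ¬aligned (i + t₀ * suc n , t ∸ suc t₀ , e ,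
              subst (λ y → ones s y (suc n) ≡ a) (sym (shift-by-multiple i (suc n) t₀<t)) e′)
        (no none) → 0 , λ t _ → ones≢min⇒suc-min balanced min _ λ e → none (t , e))

  -- Every window of length L′ + 1 = (t + 2)n has at most c < (t + 2)(a + 1) ones,
  -- so α ≤ c/(L′ + 1) < (a + 1)/n.
  aligned⇒U-suc-min : ∀ {n a} → IsMinOnes s (suc n) a → AlignedMinPair s (suc n) a →
    U α (ℤ.+ suc a / suc n)
  aligned⇒U-suc-min {n} {a} min (x , t , e₁ , e₂) = case located α c/L<[a+1]/n of λ where
      (inj₁ below) → ⊥-elim (slope-≤ s α slope {L′} {c} (λ y → balanced (suc L′) y x) below)
      (inj₂ above) → above
    where
    L′ c : ℕ
    L′ = n + (t * suc n + suc n)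
    c = ones s x (suc L′) + 1
    regroup : ∀ a t n → suc (a + (t * suc a + a) + 1) * suc n ≡ suc a * suc (n + (t * suc n + suc n))
    regroup = solve-∀
    c/L<[a+1]/n : ℤ.+ c / suc L′ <ℚ ℤ.+ suc a / suc n
    c/L<[a+1]/n = *<*⇒/<ℚ/ c L′ (suc a) n (subst (c * suc n <_) (regroup a t n)
      (*-monoˡ-< (suc n) (s≤s (+-monoˡ-≤ 1 (ones-across-aligned-mins balanced min x t e₁ e₂)))))

  minOnes-isFloor : ∀ {n a} → IsMinOnes s (suc n) a → DoubleNegation (IsFloor α (suc n) a)
  minOnes-isFloor {n} {a} min = do
    aligned ← minOnes-aligned min
    pure (slope-≥ s α slope (lower min) , aligned⇒U-suc-min min aligned)

  prefixNormal⇒P≡suc-min : PrefixNormal s → ∀ {n a} → IsMinOnes s (suc n) a → P s (suc n) ≡ suc a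
  prefixNormal⇒P≡suc-min pn {n} {a} min = decidable-stable (_ ≟ _) do
    (j , e) ← suc-min-attained min
    pure (≤-antisym (ones-≤-suc-min balanced min 0) (subst (_≤ P s (suc n)) e (pn (suc n) j)))

  P≡suc-min⇒prefixNormal : (∀ n a → IsMinOnes s (suc n) a → P s (suc n) ≡ suc a) → PrefixNormal s
  P≡suc-min⇒prefixNormal P≡ zero    j = z≤n
  P≡suc-min⇒prefixNormal P≡ (suc n) j = decidable-stable (_ ≤? _) do
    (a , min) ← minOnes-exists balanced (suc n)
    pure (subst (ones s j (suc n) ≤_) (sym (P≡ n a min)) (ones-≤-suc-min balanced min j))

  prefixNormal⇒oneCharWord : PrefixNormal s → IsOneCharWord α s
  prefixNormal⇒oneCharWord pn = starts-with-1 , bit≡floor-difference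
    where
    open ≡-Reasoning
    P≡suc-floor : ∀ {n f} → IsFloor α (suc n) f → P s (suc n) ≡ suc f
    P≡suc-floor {n} {f} F = decidable-stable (_ ≟ _) do
      (a , min) ← minOnes-exists balanced (suc n)
      F′ ← minOnes-isFloor min
      pure (trans (prefixNormal⇒P≡suc-min pn min) (cong suc (IsFloor-unique {α} {n} F′ F)))
    starts-with-1 : s 0 ≡ true
    starts-with-1 = decidable-stable (s 0 Bool.≟ true) do
      (a , min) ← minOnes-exists balanced 1
      pure (proj₁ (ones₁≡suc⇒true×zero s 0 (prefixNormal⇒P≡suc-min pn {0} min)))
    bit≡floor-difference : ∀ k f g → IsFloor α (suc k) f → IsFloor α (suc (suc k)) g →
      bit (s (suc k)) ≡ g ∸ f
    bit≡floor-difference k f g F G = sym (begin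
      g ∸ f                    ≡⟨ cong (_∸ f) (suc-injective P-step) ⟩
      f + bit (s (suc k)) ∸ f  ≡⟨ m+n∸m≡n f _ ⟩
      bit (s (suc k))          ∎)
      where
      P-step : suc g ≡ suc f + bit (s (suc k))
      P-step = begin
        suc g                          ≡⟨ sym (P≡suc-floor G) ⟩
        P s (suc (suc k))              ≡⟨ ones-suc s 0 (suc k) ⟩
        P s (suc k) + bit (s (suc k))  ≡⟨ cong (_+ bit (s (suc k))) (P≡suc-floor F) ⟩
        suc f + bit (s (suc k))        ∎

  oneCharWord⇒P≡suc-min : IsOneCharWord α s → ∀ n a → IsMinOnes s (suc n) a → P s (suc n) ≡ suc a
  oneCharWord⇒P≡suc-min (s₀≡1 , _) zero a min = decidable-stable (_ ≟ _) do
    (j , e) ← suc-min-attained min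
    pure (trans (cong (λ b → bit b + 0) s₀≡1) (cong suc (sym (proj₂ (ones₁≡suc⇒true×zero s j e)))))
  oneCharWord⇒P≡suc-min oneChar@(_ , bit≡floor-difference) (suc n) b minᵦ =
    decidable-stable (_ ≟ _) do
      (a , minₐ) ← minOnes-exists balanced (suc n)
      Fₐ ← minOnes-isFloor minₐ
      Fᵦ ← minOnes-isFloor minᵦ
      pure (begin
        P s (suc (suc n))              ≡⟨ ones-suc s 0 (suc n) ⟩
        P s (suc n) + bit (s (suc n))  ≡⟨ cong₂ _+_ (oneCharWord⇒P≡suc-min oneChar n a minₐ)
                                                    (bit≡floor-difference n a b Fₐ Fᵦ) ⟩
        suc a + (b ∸ a)                ≡⟨ cong suc (m+[n∸m]≡n (minOnes-mono minₐ minᵦ)) ⟩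
        suc b                          ∎)
    where open ≡-Reasoning

theorem2 : (s : Word) → Sturmian s → (α : Real) → IsSlope s α →
    (PrefixNormal s ⇔ IsOneCharWord α s)
theorem2 s (balanced , aperiodic) α slope = mk⇔
  prefixNormal⇒oneCharWord
  (λ oneChar → P≡suc-min⇒prefixNormal (oneCharWord⇒P≡suc-min oneChar))
  where open Sturmian s balanced aperiodic α slope
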